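{- Let $F$ be the symmetric random walk on $\mathbb{Z}$, i.e. $F(x) = \tfrac12\delta_{x-1}+\tfrac12\delta_{x+1}$ for $x\in\mathbb{Z}$, and let $A=\mathbb{Z}\setminus\{0\}$, $B=\{0\}$. Then for no $m\ge 1$ is there a function $r:\mathbb{Z}\to[0,\infty)^m$ that is a lexicographic generalised Streett supermartingale for $(F,(A,B))$.
   Context: $\mathbb{Z}$ carries the discrete $\sigma$-algebra; $(\mathbb{X}r)(x) = \tfrac12 r(x-1)+\tfrac12 r(x+1)$ (componentwise). On $[0,\infty]^m$ define $(r_1,\dots,r_m)\succ(r'_1,\dots,r'_m)$ iff there is $l$ with $r_i\ge r'_i$ for all $i<l$ and $r_l\ge 1+r'_l$; and $r\succeq r'$ iff $r\succ r'$ or $r_i\ge r'_i$ for all $i$. A lexicographic generalised Streett supermartingale for $(F,(A,B))$ is a function $r:\mathbb{Z}\to[0,\infty)^m$ with $(\mathbb{X}r)(x)\prec r(x)$ for all $x\in A\setminus B$ and $(\mathbb{X}r)(x)\preceq r(x)$ for all $x\notin A\cup B$. -}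

module Defs where

open import Level using (0ℓ)
open import Data.Nat using (ℕ; suc)
open import Data.Fin using (Fin; _<_)
open import Data.Integer as ℤ using (ℤ; 0ℤ; 1ℤ)
open import Data.Product using (Σ; ∃; _×_)
open import Data.Sum using (_⊎_)
open import Relation.Nullary using (¬_)
open import Relation.Binary.PropositionalEquality using (_≡_)
import Algebra.Structures as AS
import Relation.Binary.Structures as RS

-- An axiomatisation of the real numbers: a Dedekind-complete (least-upper-bound)
-- ordered field.  Every model is (classically) isomorphic to ℝ, so quantifying
-- over all models is the same as speaking about ℝ.
record RealField : Set₁ where
  infixl 6 _+_
  infixl 7 _*_
  infix 4 _≤_
  field
    ℝ : Set
    _+_ _*_ : ℝ → ℝ → ℝ
    -_ : ℝ → ℝ
    0r 1r : ℝ
    _≤_ : ℝ → ℝ → Set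
    isCommutativeRing : AS.IsCommutativeRing {A = ℝ} _≡_ _+_ _*_ -_ 0r 1r
    isTotalOrder : RS.IsTotalOrder {A = ℝ} _≡_ _≤_
    0≢1 : ¬ (0r ≡ 1r)
    inverse : ∀ x → ¬ (x ≡ 0r) → Σ ℝ (λ y → x * y ≡ 1r)
    +-mono-≤ : ∀ x y z → x ≤ y → x + z ≤ y + z
    *-nonneg : ∀ x y → 0r ≤ x → 0r ≤ y → 0r ≤ x * y
    lub : (S : ℝ → Set) → Σ ℝ S → Σ ℝ (λ b → ∀ s → S s → s ≤ b) →
          Σ ℝ (λ u → (∀ s → S s → s ≤ u) × (∀ b → (∀ s → S s → s ≤ b) → u ≤ b))
    ½ : ℝ
    ½-inverse : ½ * (1r + 1r) ≡ 1r

module _ (R : RealField) where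
  open RealField R

  Vecℝ : ℕ → Set
  Vecℝ m = Fin m → ℝ

  _≻_ : ∀ {m} → Vecℝ m → Vecℝ m → Set
  _≻_ {m} r r' = ∃ λ (l : Fin m) → (∀ i → i < l → r' i ≤ r i) × (1r + r' l ≤ r l)

  _⪰_ : ∀ {m} → Vecℝ m → Vecℝ m → Set
  r ⪰ r' = (r ≻ r') ⊎ (∀ i → r' i ≤ r i)

  𝕏 : ∀ {m} → (ℤ → Vecℝ m) → ℤ → Vecℝ m
  𝕏 r x i = ½ * (r (x ℤ.- 1ℤ) i + r (x ℤ.+ 1ℤ) i)

  IsLexGenStreettSM : ∀ m → (A B : ℤ → Set) → (ℤ → Vecℝ m) → Set
  IsLexGenStreettSM m A B r =
    (∀ x i → 0r ≤ r x i) ×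
    (∀ x → A x → ¬ B x → r x ≻ 𝕏 r x) ×
    (∀ x → ¬ A x → ¬ B x → r x ⪰ 𝕏 r x)

Aset : ℤ → Set
Aset x = ¬ (x ≡ 0ℤ)

Bset : ℤ → Set
Bset x = x ≡ 0ℤ

{-# OPTIONS --safe #-}
-- Write Δ G n = G n - G (n+1) for the coordinates G of r along the positive integers.
-- There every step is a strict lexicographic decrease r(x) ≻ (𝕏 r)(x), which says that
-- the coordinates below the decreasing level l(x) are midpoint concave (Δ does not decrease)
-- and coordinate l(x) is strictly so (Δ grows by at least 1).  A coordinate that is concave
-- from some point on and strictly concave infinitely often has Δ eventually ≥ 1, so it
-- eventually becomes negative (Archimedes).  By induction on k, the level is therefore
-- eventually above every k < m, which is absurd for l(x) : Fin m.  Since the goal is ⊥,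
-- "eventually" and "infinitely often" only need to hold under double negation.
module Submission where

open import Defs
open import Data.Nat using (ℕ; _≥_)
open import Data.Integer using (ℤ)
open import Data.Product using (Σ)
open import Relation.Nullary using (¬_)

open import Level using (0ℓ)
open import Function using (_∘_; id)
open import Algebra.Bundles using (CommutativeRing)
open import Relation.Binary.Bundles using (Poset)
import Algebra.Properties.CommutativeSemigroup as CommutativeSemigroupProperties
import Algebra.Properties.Group as GroupProperties
import Algebra.Properties.Ring as RingProperties
open import Data.Empty using (⊥; ⊥-elim)
open import Data.Fin as Fin using (Fin; toℕ; fromℕ<)
open import Data.Fin.Properties using (toℕ<n; toℕ-fromℕ<; toℕ-injective)
import Data.Nat as Nat
open Nat using (zero; suc; z≤n)
import Data.Nat.Properties as Natₚ
import Data.Integer as Int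
open import Data.Product using (∃; _×_; _,_; proj₁; proj₂; map₂)
open import Data.Sum using (inj₁; inj₂; [_,_]′)
open import Effect.Monad using (RawMonad)
open import Relation.Binary.PropositionalEquality
  using (_≡_; refl; sym; trans; cong; cong₂; subst; subst₂)
open import Relation.Nullary.Negation using (¬¬-Monad; ¬¬-map)
import Relation.Binary.Reasoning.PartialOrder as PartialOrderReasoning
import Relation.Binary.Structures as RS

open RawMonad (¬¬-Monad {0ℓ}) using (pure; _>>=_)

Eventually : (ℕ → Set) → Set
Eventually P = ∃ λ M → ∀ n → M Nat.≤ n → P n

InfinitelyOften : (ℕ → Set) → Set
InfinitelyOften P = ∀ M → ¬ ¬ ∃ λ n → M Nat.≤ n × P n

¬infinitelyOften⇒¬¬eventually¬ : ∀ {P} → ¬ InfinitelyOften P → ¬ ¬ Eventually (¬_ ∘ P)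
¬infinitelyOften⇒¬¬eventually¬ ¬io ¬ev =
  ¬io λ M ¬witness → ¬ev (M , λ n M≤n Pn → ¬witness (n , M≤n , Pn))

eventually-zipWith : ∀ {P Q S : ℕ → Set} → (∀ {n} → P n → Q n → S n) →
                     Eventually P → Eventually Q → Eventually S
eventually-zipWith f (M , p) (M′ , q) =
  M Nat.⊔ M′ , λ n M⊔M′≤n → f (p n (Natₚ.≤-trans (Natₚ.m≤m⊔n M M′) M⊔M′≤n))
                             (q n (Natₚ.≤-trans (Natₚ.m≤n⊔m M M′) M⊔M′≤n))

module _ (R : RealField) where
  open RealField R hiding (+-mono-≤)

  commutativeRing : CommutativeRing 0ℓ 0ℓ
  commutativeRing = record { isCommutativeRing = isCommutativeRing }

  open CommutativeRing commutativeRing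
    using (_-_; +-comm; +-assoc; +-identityˡ; +-identityʳ; -‿inverseʳ;
           *-identityˡ; *-identityʳ; distribˡ; distribʳ; +-group; +-rawMonoid;
           +-commutativeSemigroup; ring)
  open CommutativeSemigroupProperties +-commutativeSemigroup
    using (interchange; xy∙z≈xz∙y; xy∙z≈y∙xz; xy∙z≈yz∙x)
  open GroupProperties +-group using (⁻¹-involutive; //-rightDividesˡ; //-rightDividesʳ)
  open RingProperties ring using (-1*x≈-x)
  open import Algebra.Definitions.RawMonoid +-rawMonoid using () renaming (_×_ to _×ᵣ_)
  open RS.IsTotalOrder isTotalOrder using (total; antisym; reflexive; isPartialOrder)
    renaming (refl to ≤-refl; trans to ≤-trans)

  poset : Poset 0ℓ 0ℓ 0ℓ
  poset = record { isPartialOrder = isPartialOrder }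

  open PartialOrderReasoning poset
    using (begin_; begin-equality_; step-≤; step-≡-⟩; step-≡-⟨; _∎)

  +-monoʳ-≤ : ∀ {x y} z → x ≤ y → x + z ≤ y + z
  +-monoʳ-≤ z x≤y = RealField.+-mono-≤ R _ _ z x≤y

  +-monoˡ-≤ : ∀ {x y} z → x ≤ y → z + x ≤ z + y
  +-monoˡ-≤ {x} {y} z x≤y = subst₂ _≤_ (+-comm x z) (+-comm y z) (+-monoʳ-≤ z x≤y)

  +-mono-≤ : ∀ {a b c d} → a ≤ b → c ≤ d → a + c ≤ b + d
  +-mono-≤ {b = b} {c} a≤b c≤d = ≤-trans (+-monoʳ-≤ c a≤b) (+-monoˡ-≤ b c≤d)

  +-cancelʳ-≤ : ∀ {x y} z → x + z ≤ y + z → x ≤ y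
  +-cancelʳ-≤ {x} {y} z x+z≤y+z =
    subst₂ _≤_ (//-rightDividesʳ z x) (//-rightDividesʳ z y) (+-monoʳ-≤ (- z) x+z≤y+z)

  0≤1 : 0r ≤ 1r
  0≤1 with total 0r 1r
  ... | inj₁ 0≤1′ = 0≤1′
  ... | inj₂ 1≤0 = subst (0r ≤_) -1*-1≡1 (*-nonneg _ _ 0≤-1 0≤-1)
    where
      0≤-1 : 0r ≤ - 1r
      0≤-1 = subst₂ _≤_ (-‿inverseʳ 1r) (+-identityˡ (- 1r)) (+-monoʳ-≤ (- 1r) 1≤0)
      -1*-1≡1 : - 1r * - 1r ≡ 1r
      -1*-1≡1 = trans (-1*x≈-x (- 1r)) (⁻¹-involutive 1r)

  x≤y+x : ∀ {x y} → 0r ≤ y → x ≤ y + x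
  x≤y+x {x} {y} 0≤y = subst (_≤ y + x) (+-identityˡ x) (+-monoʳ-≤ x 0≤y)

  x≤x+1 : ∀ x → x ≤ x + 1r
  x≤x+1 x = subst (_≤ x + 1r) (+-identityʳ x) (+-monoˡ-≤ x 0≤1)

  Naturals : ℝ → Set
  Naturals s = ∃ λ n → n ×ᵣ 1r ≡ s

  n×1-unbounded : ∀ b → ¬ (∀ n → n ×ᵣ 1r ≤ b)
  n×1-unbounded b n≤b with lub Naturals (0r , 0 , refl) (b , λ { _ (n , refl) → n≤b n })
  ... | u , u-upper , u-least = 0≢1 (antisym 0≤1 1≤0)
    where
      -- the naturals are closed under successor, so u - 1 is again an upper bound
      u-1-upper : ∀ s → Naturals s → s ≤ u - 1r
      u-1-upper _ (n , refl) = begin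
        n ×ᵣ 1r               ≡⟨ //-rightDividesʳ 1r (n ×ᵣ 1r) ⟨
        n ×ᵣ 1r + 1r - 1r     ≡⟨ cong (_- 1r) (+-comm (n ×ᵣ 1r) 1r) ⟩
        suc n ×ᵣ 1r - 1r      ≤⟨ +-monoʳ-≤ (- 1r) (u-upper _ (suc n , refl)) ⟩
        u - 1r                ∎
      1≤0 : 1r ≤ 0r
      1≤0 = +-cancelʳ-≤ u (begin
        1r + u           ≡⟨ +-comm 1r u ⟩
        u + 1r           ≤⟨ +-monoʳ-≤ 1r (u-least (u - 1r) u-1-upper) ⟩
        u - 1r + 1r      ≡⟨ //-rightDividesˡ 1r u ⟩
        u                ≡⟨ +-identityˡ u ⟨
        0r + u           ∎)

  archimedean : ∀ b → ¬ ¬ ∃ λ n → b ≤ n ×ᵣ 1r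
  archimedean b ¬exceeds = n×1-unbounded b λ n →
    [ id , (λ b≤n → ⊥-elim (¬exceeds (n , b≤n))) ]′ (total (n ×ᵣ 1r) b)

  ½x+½x≡x : ∀ x → ½ * x + ½ * x ≡ x
  ½x+½x≡x x = begin-equality
    ½ * x + ½ * x           ≡⟨ distribʳ x ½ ½ ⟨
    (½ + ½) * x             ≡⟨ cong (_* x) (cong₂ _+_ (*-identityʳ ½) (*-identityʳ ½)) ⟨
    (½ * 1r + ½ * 1r) * x   ≡⟨ cong (_* x) (distribˡ ½ 1r 1r) ⟨
    ½ * (1r + 1r) * x       ≡⟨ cong (_* x) ½-inverse ⟩
    1r * x                  ≡⟨ *-identityˡ x ⟩
    x                       ∎

  sum≤double⇒gap≤ : ∀ {a b c} → a + b ≤ c + c → a - c ≤ c - b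
  sum≤double⇒gap≤ {a} {b} {c} a+b≤c+c = begin
    a - c                   ≡⟨ +-identityʳ (a - c) ⟨
    a - c + 0r              ≡⟨ cong ((a - c) +_) (-‿inverseʳ b) ⟨
    a - c + (b - b)         ≡⟨ interchange a (- c) b (- b) ⟩
    a + b + (- c - b)       ≤⟨ +-monoʳ-≤ (- c - b) a+b≤c+c ⟩
    c + c + (- c - b)       ≡⟨ interchange c c (- c) (- b) ⟩
    c - c + (c - b)         ≡⟨ cong (_+ (c - b)) (-‿inverseʳ c) ⟩
    0r + (c - b)            ≡⟨ +-identityˡ (c - b) ⟩
    c - b                   ∎

  midpoint≤⇒gap≤ : ∀ {a b c} → ½ * (a + b) ≤ c → a - c ≤ c - b
  midpoint≤⇒gap≤ {a} {b} {c} h =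
    sum≤double⇒gap≤ (subst (_≤ c + c) (½x+½x≡x (a + b)) (+-mono-≤ h h))

  midpoint<⇒gap< : ∀ {a b c} → 1r + ½ * (a + b) ≤ c → a - c + 1r ≤ c - b
  midpoint<⇒gap< {a} {b} {c} h = begin
    a - c + 1r                  ≡⟨ xy∙z≈xz∙y a 1r (- c) ⟨
    a + 1r - c                  ≤⟨ sum≤double⇒gap≤ a+1+b≤c+c ⟩
    c - b                       ∎
    where
      mid : ℝ
      mid = ½ * (a + b)
      a+1+b≤c+c : a + 1r + b ≤ c + c
      a+1+b≤c+c = begin
        a + 1r + b              ≡⟨ xy∙z≈y∙xz a 1r b ⟩
        1r + (a + b)            ≤⟨ +-monoʳ-≤ (a + b) (x≤x+1 1r) ⟩
        1r + 1r + (a + b)       ≡⟨ cong ((1r + 1r) +_) (½x+½x≡x (a + b)) ⟨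
        1r + 1r + (mid + mid)   ≡⟨ interchange 1r mid 1r mid ⟨
        (1r + mid) + (1r + mid) ≤⟨ +-mono-≤ h h ⟩
        c + c                   ∎

  Δ : (ℕ → ℝ) → ℕ → ℝ
  Δ G n = G n - G (suc n)

  ConcaveFrom : ℕ → (ℕ → ℝ) → Set
  ConcaveFrom M G = ∀ n → M Nat.≤ n → Δ G n ≤ Δ G (suc n)

  StrictlyConcaveAt : (ℕ → ℝ) → ℕ → Set
  StrictlyConcaveAt G n = Δ G n + 1r ≤ Δ G (suc n)

  Δ-mono : ∀ {M G} → ConcaveFrom M G → ∀ {m n} → M Nat.≤ m → m Nat.≤ n → Δ G m ≤ Δ G n
  Δ-mono {M} {G} concave {m} M≤m m≤n = go (Natₚ.≤⇒≤′ m≤n)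
    where
      go : ∀ {n} → m Nat.≤′ n → Δ G m ≤ Δ G n
      go (Nat.≤′-reflexive refl) = ≤-refl
      go (Nat.≤′-step m≤′n) = ≤-trans (go m≤′n) (concave _ (Natₚ.≤-trans M≤m (Natₚ.≤′⇒≤ m≤′n)))

  nonneg⇒¬eventually-Δ≥1 : ∀ {G} → (∀ n → 0r ≤ G n) → ¬ Eventually (λ n → 1r ≤ Δ G n)
  nonneg⇒¬eventually-Δ≥1 {G} nonneg (X , Δ≥1) =
    n×1-unbounded (G X) (λ i → ≤-trans (x≤y+x (nonneg (i Nat.+ X))) (descent i))
    where
      drop : ∀ n → X Nat.≤ n → G (suc n) + 1r ≤ G n
      drop n X≤n = begin
        G (suc n) + 1r                ≡⟨ +-comm (G (suc n)) 1r ⟩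
        1r + G (suc n)                ≤⟨ +-monoʳ-≤ (G (suc n)) (Δ≥1 n X≤n) ⟩
        G n - G (suc n) + G (suc n)   ≡⟨ //-rightDividesˡ (G (suc n)) (G n) ⟩
        G n                           ∎
      descent : ∀ i → G (i Nat.+ X) + i ×ᵣ 1r ≤ G X
      descent zero = reflexive (+-identityʳ (G X))
      descent (suc i) = begin
        G (suc i Nat.+ X) + (1r + i ×ᵣ 1r)   ≡⟨ +-assoc _ 1r (i ×ᵣ 1r) ⟨
        G (suc i Nat.+ X) + 1r + i ×ᵣ 1r
          ≤⟨ +-monoʳ-≤ (i ×ᵣ 1r) (drop (i Nat.+ X) (Natₚ.m≤n+m X i)) ⟩
        G (i Nat.+ X) + i ×ᵣ 1r              ≤⟨ descent i ⟩
        G X                                  ∎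

  Δ-unbounded : ∀ {M G} → ConcaveFrom M G → InfinitelyOften (StrictlyConcaveAt G) →
                  ∀ s → ¬ ¬ ∃ λ X → M Nat.≤ X × s ×ᵣ 1r + Δ G M ≤ Δ G X
  Δ-unbounded {M} {G} concave strict-often zero =
    pure (M , Natₚ.≤-refl , reflexive (+-identityˡ (Δ G M)))
  Δ-unbounded {M} {G} concave strict-often (suc s) = do
    X , M≤X , s+ΔM≤ΔX ← Δ-unbounded concave strict-often s
    j , X≤j , strict-j ← strict-often X
    pure (suc j , Natₚ.m≤n⇒m≤1+n (Natₚ.≤-trans M≤X X≤j) , (begin
      1r + s ×ᵣ 1r + Δ G M     ≡⟨ xy∙z≈yz∙x 1r (s ×ᵣ 1r) (Δ G M) ⟩
      s ×ᵣ 1r + Δ G M + 1r     ≤⟨ +-monoʳ-≤ 1r (≤-trans s+ΔM≤ΔX (Δ-mono concave M≤X X≤j)) ⟩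
      Δ G j + 1r               ≤⟨ strict-j ⟩
      Δ G (suc j)              ∎))

  nonneg-concave⇒¬infinitelyOften-strict : ∀ {M G} → (∀ n → 0r ≤ G n) → ConcaveFrom M G →
                                           ¬ InfinitelyOften (StrictlyConcaveAt G)
  nonneg-concave⇒¬infinitelyOften-strict {M} {G} nonneg concave strict-often =
    archimedean (1r - Δ G M) λ (s , 1-ΔM≤s) →
    Δ-unbounded concave strict-often s λ (X , M≤X , s+ΔM≤ΔX) →
    nonneg⇒¬eventually-Δ≥1 nonneg (X , λ n X≤n → begin
      1r                   ≡⟨ //-rightDividesˡ (Δ G M) 1r ⟨
      1r - Δ G M + Δ G M   ≤⟨ +-monoʳ-≤ (Δ G M) 1-ΔM≤s ⟩
      s ×ᵣ 1r + Δ G M      ≤⟨ s+ΔM≤ΔX ⟩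
      Δ G X                ≤⟨ Δ-mono concave M≤X X≤n ⟩
      Δ G n                ∎)

  LexStrictlyConcaveAt : ∀ {m} → (Fin m → ℕ → ℝ) → ℕ → Set
  LexStrictlyConcaveAt G n =
    ∃ λ l → (∀ i → i Fin.< l → Δ (G i) n ≤ Δ (G i) (suc n)) × StrictlyConcaveAt (G l) n

  module _ {m} {G : Fin m → ℕ → ℝ} (nonneg : ∀ i n → 0r ≤ G i n)
           (lex : ∀ n → LexStrictlyConcaveAt G n) where

    private
      level : ℕ → Fin m
      level n = proj₁ (lex n)

      level-eventually-exceeds : ∀ {k} (k<m : k Nat.< m) →
                                 Eventually (λ n → k Nat.≤ toℕ (level n)) →
                                 ¬ ¬ Eventually (λ n → k Nat.< toℕ (level n))
      level-eventually-exceeds {k} k<m (M , k≤level) =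
        ¬¬-map (eventually-zipWith Natₚ.≤∧≢⇒< (M , k≤level))
               (¬infinitelyOften⇒¬¬eventually¬ k-infinitelyOften⇒⊥)
        where
          kᶠ : Fin m
          kᶠ = fromℕ< k<m
          strict-at-k : ∀ {n} → k ≡ toℕ (level n) → StrictlyConcaveAt (G kᶠ) n
          strict-at-k {n} k≡level = subst (λ l → StrictlyConcaveAt (G l) n)
            (toℕ-injective (trans (sym k≡level) (sym (toℕ-fromℕ< k<m)))) (proj₂ (proj₂ (lex n)))
          concave : ConcaveFrom M (G kᶠ)
          concave n M≤n with Natₚ.m≤n⇒m<n∨m≡n (k≤level n M≤n)
          ... | inj₁ k<level =
            proj₁ (proj₂ (lex n)) kᶠ (subst (Nat._< toℕ (level n)) (sym (toℕ-fromℕ< k<m)) k<level)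
          ... | inj₂ k≡level = ≤-trans (x≤x+1 _) (strict-at-k k≡level)
          k-infinitelyOften⇒⊥ : ¬ InfinitelyOften (λ n → k ≡ toℕ (level n))
          k-infinitelyOften⇒⊥ k-often = nonneg-concave⇒¬infinitelyOften-strict (nonneg kᶠ) concave
            (λ M′ → ¬¬-map (map₂ (map₂ strict-at-k)) (k-often M′))

      level-eventually-≥ : ∀ k → k Nat.≤ m → ¬ ¬ Eventually (λ n → k Nat.≤ toℕ (level n))
      level-eventually-≥ zero _ = pure (0 , λ _ _ → z≤n)
      level-eventually-≥ (suc k) k<m =
        level-eventually-≥ k (Natₚ.<⇒≤ k<m) >>= level-eventually-exceeds k<m

    ¬nonneg-lexStrictlyConcave : ⊥
    ¬nonneg-lexStrictlyConcave = level-eventually-≥ m Natₚ.≤-refl λ (M , m≤level) →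
      Natₚ.<⇒≱ (toℕ<n (level M)) (m≤level M Natₚ.≤-refl)

  ≻𝕏⇒lexStrictlyConcaveAt : ∀ {m} (r : ℤ → Vecℝ R m) j →
                            _≻_ R (r (Int.+ suc j)) (𝕏 R r (Int.+ suc j)) →
                            LexStrictlyConcaveAt (λ i n → r (Int.+ n) i) j
  ≻𝕏⇒lexStrictlyConcaveAt r j (l , below , at-l) =
    l , (λ i i<l → midpoint≤⇒gap≤ (subst (_≤ r (Int.+ suc j) i) (neighbours i) (below i i<l))) ,
        midpoint<⇒gap< (subst (λ x → 1r + x ≤ r (Int.+ suc j) l) (neighbours l) at-l)
    where
      neighbours : ∀ i → 𝕏 R r (Int.+ suc j) i ≡ ½ * (r (Int.+ j) i + r (Int.+ suc (suc j)) i)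
      neighbours i = cong (λ n → ½ * (r (Int.+ j) i + r (Int.+ n) i)) (Natₚ.+-comm (suc j) 1)

propositionA1 : (R : RealField) → (m : ℕ) → m ≥ 1 →
    ¬ Σ (ℤ → Vecℝ R m) (λ r → IsLexGenStreettSM R m Aset Bset r)
propositionA1 R m _ (r , nonneg , strict-on-A , _) =
  ¬nonneg-lexStrictlyConcave R (λ i n → nonneg (Int.+ n) i)
    (λ j → ≻𝕏⇒lexStrictlyConcaveAt R r j (strict-on-A (Int.+ suc j) (λ ()) (λ ())))
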